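{- Let $q\ge 1$ and for $n,k\ge 0$ let $w_{n,k}$ be the number of $q$-decreasing binary words of length $n$ containing exactly $k$ letters $1$. Then $$\sum_{n,k\ge0}w_{n,k}x^ny^k=\frac{1-x^{q+1}y^q}{1-xy-x+x^{q+2}y^{q+1}}.$$
   Context: A binary word is $q$-decreasing ($q\ge1$) if each of its maximal factors (maximal blocks of consecutive letters) of the form $0^a1^b$ with $a>0$ satisfies $q\cdot a>b$. -}

module Defs where

open import Data.Bool using (Bool; true; false)
open import Data.Nat using (ℕ; zero; suc; _*_; _<_; _≟_)
open import Data.Integer using (ℤ; 0ℤ; 1ℤ)
open import Data.List using (List; []; _∷_; _++_; replicate; length; [_])
open import Data.Product using (Σ; ∃; _×_)
open import Data.Sum using (_⊎_)
open import Relation.Nullary using (yes; no)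
open import Relation.Nullary.Decidable using (does)
open import Relation.Binary.PropositionalEquality using (_≡_)

-- Binary words: false = letter 0, true = letter 1.
Word : Set
Word = List Bool

-- u is empty or ends with letter 1 (so a 0-run starting right after u is maximal on the left)
LeftOK : Word → Set
LeftOK u = u ≡ [] ⊎ Σ Word (λ u′ → u ≡ u′ ++ [ true ])

RightOK : ℕ → Word → Set
RightOK zero    v = v ≡ []
RightOK (suc b) v = v ≡ [] ⊎ Σ Word (λ v′ → v ≡ false ∷ v′)

-- q-decreasing: every maximal factor 0^a 1^b (a > 0) satisfies q*a > b.
-- A factor occurrence w = u ++ 0^a 1^b ++ v is maximal iff LeftOK u and RightOK b v.
QDecreasing : ℕ → Word → Set
QDecreasing q w = ∀ (u : Word) (a b : ℕ) (v : Word) →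
  w ≡ u ++ replicate a false ++ replicate b true ++ v →
  0 < a → LeftOK u → RightOK b v → b < q * a

numOnes : Word → ℕ
numOnes []           = zero
numOnes (true ∷ w)   = suc (numOnes w)
numOnes (false ∷ w)  = numOnes w

-- the set of q-decreasing words of length n with exactly k letters 1
-- (proof fields irrelevant, so elements are determined by the word)
record QWord (q n k : ℕ) : Set where
  constructor qword
  field
    word : Word
    .len  : length word ≡ n
    .ones : numOnes word ≡ k
    .qdec : QDecreasing q word

-- Bivariate formal power series with integer coefficients, as coefficient functions.
Series : Set
Series = ℕ → ℕ → ℤ

-- multiplication by the monomial x^i y^j
shift : ℕ → ℕ → Series → Series
shift zero    zero    f n       k       = f n k
shift (suc i) j       f zero    k       = 0ℤ
shift (suc i) j       f (suc n) k       = shift i j f n k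
shift zero    (suc j) f n       zero    = 0ℤ
shift zero    (suc j) f n       (suc k) = shift zero j f n k

mono : ℕ → ℕ → Series
mono i j n k with does (i ≟ n) | does (j ≟ k)
... | true | true = 1ℤ
... | _    | _    = 0ℤ

{-# OPTIONS --safe #-}
-- A q-decreasing word is read by an automaton that, inside the current block 0^a 1^b, remembers its
-- allowance q·a − 1 − b, the number of further 1s the block can take. Counting words by their final
-- state and appending one letter gives W = 1 + xW + xyW − xyB, where B counts the words of allowance 0
-- (a further 1 would be fatal). Tracing the allowance back through the last block gives
-- B = x^q y^(q−1) (1 + xyW); eliminating B gives the identity.
module Submission where

open import Defs
open import Algebra.Properties.CommutativeSemigroup as CS using ()
open import Data.Bool using (Bool; true; false; T; not; _∧_; if_then_else_)
open import Data.Unit using (tt)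
open import Data.Bool.Properties using (∧-zeroʳ; ∧-identityʳ; T-∧)
open import Data.Empty using (⊥; ⊥-elim; ⊥-elim-irr)
open import Data.Fin using (Fin)
open import Data.Fin.Permutation using (↔⇒≡)
open import Data.Fin.Properties using (+↔⊎)
open import Data.List using ([]; _∷_; [_]; _++_; _∷ʳ_; foldl; length; replicate)
open import Data.List.Properties using (foldl-∷ʳ; ++-assoc; ∷-injectiveʳ)
open import Data.Nat using (ℕ; zero; suc; _+_; _*_; _<_; z<s; s≤s; _≡ᵇ_; _≤ᵇ_; _≟_)
open import Data.Nat.Properties
  using (+-commutativeSemigroup; +-identityʳ; +-assoc; +-comm; +-suc; m<n+m; *-comm; ≤-pred; ≤ᵇ⇒≤; ≤⇒≤ᵇ; suc-injective; +-cancelʳ-≡; m+1+n≢n; >⇒≢; <-trans; m≤n+m)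
open import Data.Product using (Σ; _×_; _,_)
open import Data.Product.Function.NonDependent.Propositional using (_×-⇔_)
open import Data.Sum using (_⊎_; inj₁; inj₂)
open import Data.Sum.Function.Propositional using (_⊎-↔_)
open import Function using (_∘_)
open import Function.Construct.Composition using (_⇔-∘_)
open import Function.Construct.Symmetry using (⇔-sym)
open import Function.Properties.Equivalence using (⇔-setoid)
import Relation.Binary.Reasoning.Setoid as SetoidReasoning
open import Level using (0ℓ)
open import Function.Bundles using (_↔_; mk↔ₛ′; _⇔_; mk⇔; Equivalence)
open import Function.Properties.Inverse using (↔-sym; ↔-trans)
open import Relation.Binary.PropositionalEquality hiding ([_])
open import Relation.Nullary using (yes; no)
open import Relation.Nullary.Decidable using (dec-true; dec-false)

open CS +-commutativeSemigroup using (interchange; xy∙z≈xz∙y)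
module ⇔-Reasoning = SetoidReasoning (⇔-setoid 0ℓ)

-- Bivariate series with natural coefficients

ℕSeries : Set
ℕSeries = ℕ → ℕ → ℕ

infix 4 _≐_
_≐_ : ℕSeries → ℕSeries → Set
f ≐ g = ∀ n k → f n k ≡ g n k

infixl 6 _⊕_
_⊕_ : ℕSeries → ℕSeries → ℕSeries
(f ⊕ g) n k = f n k + g n k

δ : ℕSeries
δ zero    zero    = 1
δ zero    (suc k) = 0
δ (suc n) k       = 0

shiftℕ : ℕ → ℕ → ℕSeries → ℕSeries
shiftℕ zero    zero    f n       k       = f n k
shiftℕ (suc i) j       f zero    k       = 0
shiftℕ (suc i) j       f (suc n) k       = shiftℕ i j f n k
shiftℕ zero    (suc j) f n       zero    = 0
shiftℕ zero    (suc j) f n       (suc k) = shiftℕ zero j f n k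

shiftℕ-cong : ∀ i j {f g} → f ≐ g → shiftℕ i j f ≐ shiftℕ i j g
shiftℕ-cong zero    zero    f≐g n       k       = f≐g n k
shiftℕ-cong (suc i) j       f≐g zero    k       = refl
shiftℕ-cong (suc i) j       f≐g (suc n) k       = shiftℕ-cong i j f≐g n k
shiftℕ-cong zero    (suc j) f≐g n       zero    = refl
shiftℕ-cong zero    (suc j) f≐g n       (suc k) = shiftℕ-cong zero j f≐g n k

shiftℕ-⊕ : ∀ i j f g → shiftℕ i j (f ⊕ g) ≐ shiftℕ i j f ⊕ shiftℕ i j g
shiftℕ-⊕ zero    zero    f g n       k       = refl
shiftℕ-⊕ (suc i) j       f g zero    k       = refl
shiftℕ-⊕ (suc i) j       f g (suc n) k       = shiftℕ-⊕ i j f g n k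
shiftℕ-⊕ zero    (suc j) f g n       zero    = refl
shiftℕ-⊕ zero    (suc j) f g n       (suc k) = shiftℕ-⊕ zero j f g n k

shiftℕ-suc-zero : ∀ i j f n → shiftℕ i (suc j) f n zero ≡ 0
shiftℕ-suc-zero zero    j f n       = refl
shiftℕ-suc-zero (suc i) j f zero    = refl
shiftℕ-suc-zero (suc i) j f (suc n) = shiftℕ-suc-zero i j f n

shiftℕ-suc-suc : ∀ i j f n k → shiftℕ i (suc j) f n (suc k) ≡ shiftℕ i j f n k
shiftℕ-suc-suc zero    j f n       k = refl
shiftℕ-suc-suc (suc i) j f zero    k = refl
shiftℕ-suc-suc (suc i) j f (suc n) k = shiftℕ-suc-suc i j f n k

shiftℕ-shiftℕ : ∀ i j i′ j′ f → shiftℕ i j (shiftℕ i′ j′ f) ≐ shiftℕ (i + i′) (j + j′) f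
shiftℕ-shiftℕ (suc i) j       i′ j′ f zero    k       = refl
shiftℕ-shiftℕ (suc i) j       i′ j′ f (suc n) k       = shiftℕ-shiftℕ i j i′ j′ f n k
shiftℕ-shiftℕ zero    zero    i′ j′ f n       k       = refl
shiftℕ-shiftℕ zero    (suc j) i′ j′ f n       zero    = sym (shiftℕ-suc-zero i′ (j + j′) f n)
shiftℕ-shiftℕ zero    (suc j) i′ j′ f n       (suc k) =
  trans (shiftℕ-shiftℕ zero j i′ j′ f n k) (sym (shiftℕ-suc-suc i′ (j + j′) f n k))

shiftℕ-index : ∀ {i i′ j j′} f → i ≡ i′ → j ≡ j′ → shiftℕ i j f ≐ shiftℕ i′ j′ f
shiftℕ-index f refl refl n k = refl

-- Counting words by length and number of ones

count : (Word → Bool) → ℕSeries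
count P zero    zero    = if P [] then 1 else 0
count P zero    (suc k) = 0
count P (suc n) zero    = count (P ∘ (false ∷_)) n zero
count P (suc n) (suc k) = count (P ∘ (false ∷_)) n (suc k) + count (P ∘ (true ∷_)) n k

record Counted (P : Word → Bool) (n k : ℕ) : Set where
  constructor counted
  field
    word    : Word
    .length≡ : length word ≡ n
    .ones≡   : numOnes word ≡ k
    .holds   : T (P word)

module _ {P : Word → Bool} {n : ℕ} where

  cons-false-↔ : Counted (P ∘ (false ∷_)) n zero ↔ Counted P (suc n) zero
  cons-false-↔ = mk↔ₛ′ to from to∘from (λ _ → refl)
    where
    to : Counted (P ∘ (false ∷_)) n zero → Counted P (suc n) zero
    to (counted u l o h) = counted (false ∷ u) (cong suc l) o h
    from : Counted P (suc n) zero → Counted (P ∘ (false ∷_)) n zero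
    from (counted (false ∷ u) l o h) = counted u (suc-injective l) o h
    from (counted (true ∷ u) l () h)
    to∘from : ∀ c → to (from c) ≡ c
    to∘from (counted (false ∷ u) l o h) = refl
    to∘from (counted (true ∷ u) l () h)

  cons-↔ : ∀ {k} → (Counted (P ∘ (false ∷_)) n (suc k) ⊎ Counted (P ∘ (true ∷_)) n k) ↔ Counted P (suc n) (suc k)
  cons-↔ {k} = mk↔ₛ′ to from to∘from from∘to
    where
    to : Counted (P ∘ (false ∷_)) n (suc k) ⊎ Counted (P ∘ (true ∷_)) n k → Counted P (suc n) (suc k)
    to (inj₁ (counted u l o h)) = counted (false ∷ u) (cong suc l) o h
    to (inj₂ (counted u l o h)) = counted (true ∷ u) (cong suc l) (cong suc o) h
    from : Counted P (suc n) (suc k) → Counted (P ∘ (false ∷_)) n (suc k) ⊎ Counted (P ∘ (true ∷_)) n k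
    from (counted (false ∷ u) l o h) = inj₁ (counted u (suc-injective l) o h)
    from (counted (true ∷ u) l o h)  = inj₂ (counted u (suc-injective l) (suc-injective o) h)
    to∘from : ∀ c → to (from c) ≡ c
    to∘from (counted (false ∷ u) l o h) = refl
    to∘from (counted (true ∷ u) l o h)  = refl
    from∘to : ∀ c → from (to c) ≡ c
    from∘to (inj₁ c) = refl
    from∘to (inj₂ c) = refl

empty-↔ : ∀ {P} → P [] ≡ true → Fin 1 ↔ Counted P 0 0
empty-↔ {P} P[] = mk↔ₛ′ (λ _ → counted [] refl refl (subst T (sym P[]) _)) (λ _ → Fin.zero) to∘from from∘to
  where
  to∘from : ∀ (c : Counted P 0 0) → counted [] refl refl _ ≡ c
  to∘from (counted [] l o h) = refl
  to∘from (counted (x ∷ u) () o h)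
  from∘to : ∀ (i : Fin 1) → Fin.zero ≡ i
  from∘to Fin.zero = refl

Fin0-↔ : ∀ {A : Set} → (A → ⊥) → Fin 0 ↔ A
Fin0-↔ ¬a = mk↔ₛ′ (λ ()) (⊥-elim ∘ ¬a) (λ a → ⊥-elim (¬a a)) (λ ())

count-↔ : ∀ P n k → Fin (count P n k) ↔ Counted P n k
count-↔ P zero zero with P [] in P[]
... | true  = empty-↔ P[]
... | false = Fin0-↔ λ where
  (counted [] l o h)      → ⊥-elim-irr (subst T P[] h)
  (counted (_ ∷ _) () o h)
count-↔ P zero (suc k) = Fin0-↔ λ where
  (counted [] l () h)
  (counted (_ ∷ _) () o h)
count-↔ P (suc n) zero = ↔-trans (count-↔ (P ∘ (false ∷_)) n zero) cons-false-↔
count-↔ P (suc n) (suc k) =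
  ↔-trans +↔⊎ (↔-trans (count-↔ (P ∘ (false ∷_)) n (suc k) ⊎-↔ count-↔ (P ∘ (true ∷_)) n k) cons-↔)

count-unique : ∀ {m P n k} → Fin m ↔ Counted P n k → m ≡ count P n k
count-unique {P = P} {n} {k} e = ↔⇒≡ (↔-trans e (↔-sym (count-↔ P n k)))

count-cong : ∀ {P Q} → (∀ u → P u ≡ Q u) → count P ≐ count Q
count-cong P≗Q zero    zero    = cong (λ b → if b then 1 else 0) (P≗Q [])
count-cong P≗Q zero    (suc k) = refl
count-cong P≗Q (suc n) zero    = count-cong (P≗Q ∘ (false ∷_)) n zero
count-cong P≗Q (suc n) (suc k) =
  cong₂ _+_ (count-cong (P≗Q ∘ (false ∷_)) n (suc k)) (count-cong (P≗Q ∘ (true ∷_)) n k)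

count-never : ∀ {P} → (∀ u → P u ≡ false) → ∀ n k → count P n k ≡ 0
count-never P≗false zero    zero    = cong (λ b → if b then 1 else 0) (P≗false [])
count-never P≗false zero    (suc k) = refl
count-never P≗false (suc n) zero    = count-never (P≗false ∘ (false ∷_)) n zero
count-never P≗false (suc n) (suc k) =
  cong₂ _+_ (count-never (P≗false ∘ (false ∷_)) n (suc k)) (count-never (P≗false ∘ (true ∷_)) n k)

count-split : ∀ (P Q : Word → Bool) → count P ≐ count (λ u → P u ∧ Q u) ⊕ count (λ u → P u ∧ not (Q u))
count-split P Q zero zero with P [] | Q []
... | false | _     = refl
... | true  | false = refl
... | true  | true  = refl
count-split P Q zero    (suc k) = refl
count-split P Q (suc n) zero    = count-split (P ∘ (false ∷_)) (Q ∘ (false ∷_)) n zero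
count-split P Q (suc n) (suc k) =
  trans (cong₂ _+_ (count-split P₀ Q₀ n (suc k)) (count-split P₁ Q₁ n k))
        (interchange (count (λ u → P₀ u ∧ Q₀ u) n (suc k)) (count (λ u → P₀ u ∧ not (Q₀ u)) n (suc k))
                     (count (λ u → P₁ u ∧ Q₁ u) n k) (count (λ u → P₁ u ∧ not (Q₁ u)) n k))
  where
  P₀ = P ∘ (false ∷_)
  P₁ = P ∘ (true ∷_)
  Q₀ = Q ∘ (false ∷_)
  Q₁ = Q ∘ (true ∷_)

count-snoc-zero : ∀ P n → count P (suc n) zero ≡ count (P ∘ (_∷ʳ false)) n zero
count-snoc-zero P zero    = refl
count-snoc-zero P (suc n) = count-snoc-zero (P ∘ (false ∷_)) n

count-snoc-suc : ∀ P n k →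
  count P (suc n) (suc k) ≡ count (P ∘ (_∷ʳ false)) n (suc k) + count (P ∘ (_∷ʳ true)) n k
count-snoc-suc P zero    zero    = refl
count-snoc-suc P zero    (suc k) = refl
count-snoc-suc P (suc n) zero    =
  trans (cong₂ _+_ (count-snoc-suc P₀ n zero) (count-snoc-zero P₁ n))
        (xy∙z≈xz∙y (count (P₀ ∘ (_∷ʳ false)) n 1) (count (P₀ ∘ (_∷ʳ true)) n 0) (count (P₁ ∘ (_∷ʳ false)) n 0))
  where
  P₀ = P ∘ (false ∷_)
  P₁ = P ∘ (true ∷_)
count-snoc-suc P (suc n) (suc k) =
  trans (cong₂ _+_ (count-snoc-suc P₀ n (suc k)) (count-snoc-suc P₁ n k))
        (interchange (count (P₀ ∘ (_∷ʳ false)) n (suc (suc k))) (count (P₀ ∘ (_∷ʳ true)) n (suc k))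
                     (count (P₁ ∘ (_∷ʳ false)) n (suc k)) (count (P₁ ∘ (_∷ʳ true)) n k))
  where
  P₀ = P ∘ (false ∷_)
  P₁ = P ∘ (true ∷_)

-- Counting words by the final state of a deterministic automaton

module Automaton {S : Set} (step : S → Bool → S) (start : S) where

  run : Word → S
  run = foldl step start

  run-∷ʳ : ∀ x u → run (u ∷ʳ x) ≡ step (run u) x
  run-∷ʳ x u = foldl-∷ʳ step start x u

  countFinal : (S → Bool) → ℕSeries
  countFinal f = count (f ∘ run)

  countFinal-cong : ∀ {f g} → (∀ s → f s ≡ g s) → countFinal f ≐ countFinal g
  countFinal-cong f≗g = count-cong (f≗g ∘ run)

  countFinal-never : ∀ {f} → (∀ s → f s ≡ false) → ∀ n k → countFinal f n k ≡ 0
  countFinal-never f≗false = count-never (f≗false ∘ run)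

  countFinal-split : ∀ f g → countFinal f ≐ countFinal (λ s → f s ∧ g s) ⊕ countFinal (λ s → f s ∧ not (g s))
  countFinal-split f g = count-split (f ∘ run) (g ∘ run)

  countFinal-suc : ∀ f n k → countFinal f (suc n) k ≡
    countFinal (λ s → f (step s false)) n k + shiftℕ 0 1 (countFinal (λ s → f (step s true))) n k
  countFinal-suc f n zero = begin
    count (f ∘ run) (suc n) zero                  ≡⟨ count-snoc-zero (f ∘ run) n ⟩
    count (f ∘ run ∘ (_∷ʳ false)) n zero          ≡⟨ count-cong (cong f ∘ run-∷ʳ false) n zero ⟩
    countFinal (λ s → f (step s false)) n zero    ≡⟨ +-identityʳ _ ⟨
    countFinal (λ s → f (step s false)) n zero + 0 ∎
    where open ≡-Reasoning
  countFinal-suc f n (suc k) =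
    trans (count-snoc-suc (f ∘ run) n k)
          (cong₂ _+_ (count-cong (cong f ∘ run-∷ʳ false) n (suc k)) (count-cong (cong f ∘ run-∷ʳ true) n k))

  countFinal-after-0 : ∀ f → f start ≡ false → (∀ s → f (step s true) ≡ false) →
    countFinal f ≐ shiftℕ 1 0 (countFinal (λ s → f (step s false)))
  countFinal-after-0 f f₀ f₁ zero    zero    = cong (λ b → if b then 1 else 0) f₀
  countFinal-after-0 f f₀ f₁ zero    (suc k) = refl
  countFinal-after-0 f f₀ f₁ (suc n) k =
    trans (countFinal-suc f n k) (trans (cong₂ _+_ refl (no-one k)) (+-identityʳ _))
    where
    no-one : ∀ k → shiftℕ 0 1 (countFinal (λ s → f (step s true))) n k ≡ 0
    no-one zero    = refl
    no-one (suc k) = countFinal-never f₁ n k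

  countFinal-after-1 : ∀ f → f start ≡ false → (∀ s → f (step s false) ≡ false) →
    countFinal f ≐ shiftℕ 1 1 (countFinal (λ s → f (step s true)))
  countFinal-after-1 f f₀ f₁ zero    zero    = cong (λ b → if b then 1 else 0) f₀
  countFinal-after-1 f f₀ f₁ zero    (suc k) = refl
  countFinal-after-1 f f₀ f₁ (suc n) k = trans (countFinal-suc f n k) (cong₂ _+_ (countFinal-never f₁ n k) refl)

-- Maximal factors

NotHead : Bool → Word → Set
NotHead c xs = ∀ {ys} → xs ≢ c ∷ ys

replicate-++-injective : ∀ {c} a b {xs ys} → NotHead c xs → NotHead c ys →
  replicate a c ++ xs ≡ replicate b c ++ ys → a ≡ b × xs ≡ ys
replicate-++-injective zero    zero    _  _  eq = refl , eq
replicate-++-injective zero    (suc b) nx _  eq = ⊥-elim (nx eq)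
replicate-++-injective (suc a) zero    _  ny eq = ⊥-elim (ny (sym eq))
replicate-++-injective (suc a) (suc b) nx ny eq with replicate-++-injective a b nx ny (∷-injectiveʳ eq)
... | refl , xs≡ys = refl , xs≡ys

RightOK-NotHead-true : ∀ {b v} → RightOK b v → NotHead true v
RightOK-NotHead-true {zero}  refl               ()
RightOK-NotHead-true {suc b} (inj₁ refl)        ()
RightOK-NotHead-true {suc b} (inj₂ (_ , refl))  ()

RightOK-NotHead-false : ∀ {b v} → RightOK b v → NotHead false (replicate b true ++ v)
RightOK-NotHead-false {zero}  refl ()
RightOK-NotHead-false {suc b} _    ()

LeftOK-true∷ : ∀ {u} → LeftOK u → LeftOK (true ∷ u)
LeftOK-true∷ (inj₁ refl)        = inj₂ ([] , refl)
LeftOK-true∷ (inj₂ (u′ , refl)) = inj₂ (true ∷ u′ , refl)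

LeftOK-ones : ∀ b {u} → LeftOK u → LeftOK (replicate b true ++ u)
LeftOK-ones zero    lu = lu
LeftOK-ones (suc b) lu = LeftOK-true∷ (LeftOK-ones b lu)

LeftOK-tail : ∀ {x u} → LeftOK (x ∷ u) → LeftOK u
LeftOK-tail (inj₁ ())
LeftOK-tail (inj₂ ([] , eq))     = inj₁ (∷-injectiveʳ eq)
LeftOK-tail (inj₂ (_ ∷ u′ , eq)) = inj₂ (u′ , ∷-injectiveʳ eq)

LeftOK-++ : ∀ xs {y ys} → LeftOK (y ∷ ys) → LeftOK (xs ++ y ∷ ys)
LeftOK-++ xs (inj₂ (u , eq)) = inj₂ (xs ++ u , trans (cong (xs ++_) eq) (sym (++-assoc xs u [ true ])))

skip-zeros : ∀ a {x u y} → replicate a false ++ x ≡ u ++ true ∷ y → Σ Word λ u′ → x ≡ u′ ++ true ∷ y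
skip-zeros zero    {u = u} eq       = u , eq
skip-zeros (suc a) {u = []} ()
skip-zeros (suc a) {u = _ ∷ u} eq  = skip-zeros a (∷-injectiveʳ eq)

skip-ones : ∀ b {v u r} → replicate b true ++ v ≡ u ++ true ∷ false ∷ r →
  Σ Word λ u′ → v ≡ u′ ++ false ∷ r × LeftOK u′
skip-ones zero          {u = u}  eq = u ++ [ true ] , trans eq (sym (++-assoc u [ true ] _)) , inj₂ (u , refl)
skip-ones (suc zero)    {u = []} eq = [] , ∷-injectiveʳ eq , inj₁ refl
skip-ones (suc (suc b)) {u = []} ()
skip-ones (suc b) {u = _ ∷ u}    eq = skip-ones b (∷-injectiveʳ eq)

module _ (q : ℕ) where

  QD-[] : QDecreasing q []
  QD-[] u       zero    b v eq ()
  QD-[] []      (suc a) b v ()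
  QD-[] (_ ∷ u) (suc a) b v ()

  QD-true∷ : ∀ {w} → QDecreasing q (true ∷ w) ⇔ QDecreasing q w
  QD-true∷ = mk⇔ to from
    where
    to : ∀ {w} → QDecreasing q (true ∷ w) → QDecreasing q w
    to qd u a b v eq a>0 lu = qd (true ∷ u) a b v (cong (true ∷_) eq) a>0 (LeftOK-true∷ lu)
    from : ∀ {w} → QDecreasing q w → QDecreasing q (true ∷ w)
    from qd []      zero    b v eq ()
    from qd []      (suc a) b v ()
    from qd (_ ∷ u) a       b v eq a>0 lu = qd u a b v (∷-injectiveʳ eq) a>0 (LeftOK-tail lu)

  QD-block : ∀ a b {v} → RightOK b v →
    QDecreasing q (replicate (suc a) false ++ replicate b true ++ v) ⇔ (b < q * suc a × QDecreasing q v)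
  QD-block a b {v} ro = mk⇔ (λ qd → qd [] (suc a) b v refl z<s (inj₁ refl) ro , rest b ro qd) from
    where
    zeros = replicate (suc a) false

    rest : ∀ b {v} → RightOK b v → QDecreasing q (zeros ++ replicate b true ++ v) → QDecreasing q v
    rest zero    refl qd = QD-[]
    rest (suc b) ro   qd u a′ b′ v′ refl a′>0 lu =
      qd (zeros ++ ones ++ u) a′ b′ v′ reassoc a′>0 (LeftOK-++ zeros (LeftOK-true∷ (LeftOK-ones b lu)))
      where
      ones = replicate (suc b) true
      reassoc : zeros ++ ones ++ u ++ _ ≡ (zeros ++ ones ++ u) ++ _
      reassoc = trans (cong (zeros ++_) (sym (++-assoc ones u _))) (sym (++-assoc zeros (ones ++ u) _))

    from : b < q * suc a × QDecreasing q v → QDecreasing q (zeros ++ replicate b true ++ v)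
    from (bound , qd) _ a′ b′ v′ eq a′>0 (inj₁ refl) ro′
      with replicate-++-injective (suc a) a′ (RightOK-NotHead-false ro) (RightOK-NotHead-false ro′) eq
    ... | refl , eq′ with replicate-++-injective b b′ (RightOK-NotHead-true ro) (RightOK-NotHead-true ro′) eq′
    ... | refl , _ = bound
    from (bound , qd) _ zero     b′ v′ eq () _
    from (bound , qd) _ (suc a″) b′ v′ eq a′>0 (inj₂ (u , refl)) ro′
      with skip-zeros (suc a) (trans eq (++-assoc u [ true ] _))
    ... | u₁ , eq₁ with skip-ones b eq₁
    ... | u₂ , eq₂ , lu₂ = qd u₂ (suc a″) b′ v′ eq₂ a′>0 lu₂ ro′

data Blocks : Word → Set where
  end   : Blocks []
  1∷_   : ∀ {w} → Blocks w → Blocks (true ∷ w)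
  block : ∀ a b {v} → RightOK b v → Blocks v → Blocks (replicate (suc a) false ++ replicate b true ++ v)

leading-ones : ∀ {w} → Blocks w → Σ ℕ λ b → Σ Word λ v → w ≡ replicate b true ++ v × RightOK 1 v × Blocks v
leading-ones end                = 0 , [] , refl , inj₁ refl , end
leading-ones (block a b ro bv)  = 0 , _ , refl , inj₂ (_ , refl) , block a b ro bv
leading-ones (1∷ bw) with leading-ones bw
... | b , v , refl , ro , bv    = suc b , v , refl , ro , bv

0∷-Blocks : ∀ {w} → Blocks w → Blocks (false ∷ w)
0∷-Blocks end               = block 0 0 refl end
0∷-Blocks (block a b ro bv) = block (suc a) b ro bv
0∷-Blocks (1∷ bw) with leading-ones bw
... | b , v , refl , ro , bv = block 0 (suc b) ro bv

blocks : ∀ w → Blocks w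
blocks []          = end
blocks (true ∷ w)  = 1∷ blocks w
blocks (false ∷ w) = 0∷-Blocks (blocks w)

+-cancelʳ-≡ᵇ : ∀ o m n → (m + o ≡ᵇ n + o) ≡ (m ≡ᵇ n)
+-cancelʳ-≡ᵇ o m n with m ≟ n
... | yes m≡n = trans (dec-true (m + o ≟ n + o) (cong (_+ o) m≡n)) (sym (dec-true (m ≟ n) m≡n))
... | no  m≢n = trans (dec-false (m + o ≟ n + o) (m≢n ∘ +-cancelʳ-≡ o m n)) (sym (dec-false (m ≟ n) m≢n))

-- The automaton for q-decreasing words

-- inZeros e and inOnes e: inside the 0-run, resp. the 1-run, of a block with allowance e.
data State : Set where
  initial : State
  inZeros : ℕ → State
  inOnes  : ℕ → State
  dead    : State

spend : ℕ → State
spend zero    = dead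
spend (suc e) = inOnes e

live : State → Bool
live dead = false
live _    = true

inZeroRun : State → Bool
inZeroRun (inZeros _) = true
inZeroRun _           = false

atBoundary : State → Bool
atBoundary initial    = true
atBoundary (inOnes _) = true
atBoundary _          = false

allowance zerosWith onesWith : ℕ → State → Bool
allowance e (inZeros d) = d ≡ᵇ e
allowance e (inOnes d)  = d ≡ᵇ e
allowance e _           = false
zerosWith e (inZeros d) = d ≡ᵇ e
zerosWith e _           = false
onesWith e (inOnes d)   = d ≡ᵇ e
onesWith e _            = false

module QAutomaton (p : ℕ) where

  q : ℕ
  q = suc p

  step : State → Bool → State
  step initial     true  = initial
  step initial     false = inZeros p
  step (inZeros e) true  = spend e
  step (inZeros e) false = inZeros (e + q)
  step (inOnes e)  true  = spend e
  step (inOnes e)  false = inZeros p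
  step dead        _     = dead

  open Automaton step initial public

  accepts : Word → Bool
  accepts w = live (run w)

  run-dead : ∀ u → foldl step dead u ≡ dead
  run-dead []      = refl
  run-dead (_ ∷ u) = run-dead u

  run-zeros : ∀ a d x → foldl step (inZeros d) (replicate a false ++ x) ≡ foldl step (inZeros (d + a * q)) x
  run-zeros zero    d x = cong (λ e → foldl step (inZeros e) x) (sym (+-identityʳ d))
  run-zeros (suc a) d x = trans (run-zeros a (d + q) x) (cong (λ e → foldl step (inZeros e) x) (+-assoc d q (a * q)))

  -- From inOnes d, as from initial, a 0 opens a new block.
  live-run-ones : ∀ b d {v} → NotHead true v →
    live (foldl step (inOnes d) (replicate b true ++ v)) ≡ (b ≤ᵇ d) ∧ accepts v
  live-run-ones zero          d       {[]}        _  = refl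
  live-run-ones zero          d       {false ∷ v} _  = refl
  live-run-ones zero          d       {true ∷ v}  nh = ⊥-elim (nh refl)
  live-run-ones (suc b)       zero    {v} nh = cong live (run-dead (replicate b true ++ v))
  live-run-ones (suc zero)    (suc d) nh = live-run-ones zero d nh
  live-run-ones (suc (suc b)) (suc d) nh = live-run-ones (suc b) d nh

  accepts-block : ∀ a b {v} → RightOK b v →
    accepts (replicate (suc a) false ++ replicate b true ++ v) ≡ (b ≤ᵇ p + a * q) ∧ accepts v
  accepts-block a b ro = trans (cong live (run-zeros a p _)) (after-zeros b ro)
    where
    after-zeros : ∀ b {v} → RightOK b v → live (foldl step (inZeros (p + a * q)) (replicate b true ++ v)) ≡ (b ≤ᵇ p + a * q) ∧ accepts v
    after-zeros zero    refl = refl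
    after-zeros (suc b) ro   = live-run-ones (suc b) (p + a * q) (RightOK-NotHead-true {suc b} ro)

  block-bound : ∀ a b → T (b ≤ᵇ p + a * q) ⇔ b < q * suc a
  block-bound a b = mk⇔ (λ t → subst (b <_) (*-comm (suc a) q) (s≤s (≤ᵇ⇒≤ b _ t)))
                        (λ lt → ≤⇒≤ᵇ (≤-pred (subst (b <_) (*-comm q (suc a)) lt)))

  QD⇔accepts-Blocks : ∀ {w} → Blocks w → QDecreasing q w ⇔ T (accepts w)
  QD⇔accepts-Blocks end               = mk⇔ (λ _ → tt) (λ _ → QD-[] q)
  QD⇔accepts-Blocks (1∷ bw)           = QD⇔accepts-Blocks bw ⇔-∘ QD-true∷ q
  QD⇔accepts-Blocks (block a b {v} ro bv) = begin
    QDecreasing q (replicate (suc a) false ++ replicate b true ++ v)    ≈⟨ QD-block q a b ro ⟩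
    (b < q * suc a × QDecreasing q v)                                  ≈⟨ ⇔-sym (block-bound a b) ×-⇔ QD⇔accepts-Blocks bv ⟩
    (T (b ≤ᵇ p + a * q) × T (accepts v))                               ≈⟨ ⇔-sym T-∧ ⟩
    T ((b ≤ᵇ p + a * q) ∧ accepts v)                                   ≡⟨ cong T (accepts-block a b ro) ⟨
    T (accepts (replicate (suc a) false ++ replicate b true ++ v))      ∎
    where open ⇔-Reasoning

  QD⇔accepts : ∀ w → QDecreasing q w ⇔ T (accepts w)
  QD⇔accepts w = QD⇔accepts-Blocks (blocks w)

  live-step-false : ∀ s → live (step s false) ≡ live s
  live-step-false initial     = refl
  live-step-false (inZeros e) = refl
  live-step-false (inOnes e)  = refl
  live-step-false dead        = refl

  live-step-true : ∀ s → live s ∧ not (allowance 0 s) ≡ live (step s true)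
  live-step-true initial           = refl
  live-step-true (inZeros zero)    = refl
  live-step-true (inZeros (suc e)) = refl
  live-step-true (inOnes zero)     = refl
  live-step-true (inOnes (suc e))  = refl
  live-step-true dead              = refl

  live-allowance : ∀ s → live s ∧ allowance 0 s ≡ allowance 0 s
  live-allowance initial     = refl
  live-allowance (inZeros e) = refl
  live-allowance (inOnes e)  = refl
  live-allowance dead        = refl

  allowance-inZeroRun : ∀ e s → allowance e s ∧ inZeroRun s ≡ zerosWith e s
  allowance-inZeroRun e initial     = refl
  allowance-inZeroRun e (inZeros d) = ∧-identityʳ (d ≡ᵇ e)
  allowance-inZeroRun e (inOnes d)  = ∧-zeroʳ (d ≡ᵇ e)
  allowance-inZeroRun e dead        = refl

  allowance-inOneRun : ∀ e s → allowance e s ∧ not (inZeroRun s) ≡ onesWith e s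
  allowance-inOneRun e initial     = refl
  allowance-inOneRun e (inZeros d) = ∧-zeroʳ (d ≡ᵇ e)
  allowance-inOneRun e (inOnes d)  = ∧-identityʳ (d ≡ᵇ e)
  allowance-inOneRun e dead        = refl

  zerosWith-step-true : ∀ e s → zerosWith e (step s true) ≡ false
  zerosWith-step-true e initial           = refl
  zerosWith-step-true e (inZeros zero)    = refl
  zerosWith-step-true e (inZeros (suc d)) = refl
  zerosWith-step-true e (inOnes zero)     = refl
  zerosWith-step-true e (inOnes (suc d))  = refl
  zerosWith-step-true e dead              = refl

  onesWith-step-false : ∀ e s → onesWith e (step s false) ≡ false
  onesWith-step-false e initial     = refl
  onesWith-step-false e (inZeros d) = refl
  onesWith-step-false e (inOnes d)  = refl
  onesWith-step-false e dead        = refl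

  onesWith-step-true : ∀ e s → onesWith e (step s true) ≡ allowance (suc e) s
  onesWith-step-true e initial           = refl
  onesWith-step-true e (inZeros zero)    = refl
  onesWith-step-true e (inZeros (suc d)) = refl
  onesWith-step-true e (inOnes zero)     = refl
  onesWith-step-true e (inOnes (suc d))  = refl
  onesWith-step-true e dead              = refl

  atBoundary-step-false : ∀ s → atBoundary (step s false) ≡ false
  atBoundary-step-false initial     = refl
  atBoundary-step-false (inZeros d) = refl
  atBoundary-step-false (inOnes d)  = refl
  atBoundary-step-false dead        = refl

  atBoundary-step-true : ∀ s → atBoundary (step s true) ≡ live (step s true)
  atBoundary-step-true initial           = refl
  atBoundary-step-true (inZeros zero)    = refl
  atBoundary-step-true (inZeros (suc d)) = refl
  atBoundary-step-true (inOnes zero)     = refl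
  atBoundary-step-true (inOnes (suc d))  = refl
  atBoundary-step-true dead              = refl

  zerosWith-p-step-false : ∀ s → zerosWith p (step s false) ≡ atBoundary s
  zerosWith-p-step-false initial     = dec-true (p ≟ p) refl
  zerosWith-p-step-false (inZeros d) = dec-false (d + q ≟ p) (m+1+n≢n d)
  zerosWith-p-step-false (inOnes d)  = dec-true (p ≟ p) refl
  zerosWith-p-step-false dead        = refl

  zerosWith-<p-step-false : ∀ {e} s → e < p → zerosWith e (step s false) ≡ false
  zerosWith-<p-step-false initial     e<p = dec-false (p ≟ _) (>⇒≢ e<p)
  zerosWith-<p-step-false (inZeros d) e<p = dec-false (d + q ≟ _) (>⇒≢ (<-trans e<p (m≤n+m (suc p) d)))
  zerosWith-<p-step-false (inOnes d)  e<p = dec-false (p ≟ _) (>⇒≢ e<p)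
  zerosWith-<p-step-false dead        e<p = refl

  zerosWith-+q-step-false : ∀ e s → zerosWith (e + q) (step s false) ≡ zerosWith e s
  zerosWith-+q-step-false e initial     = dec-false (p ≟ e + q) (≢-sym (m+1+n≢n e))
  zerosWith-+q-step-false e (inZeros d) = +-cancelʳ-≡ᵇ q d e
  zerosWith-+q-step-false e (inOnes d)  = dec-false (p ≟ e + q) (≢-sym (m+1+n≢n e))
  zerosWith-+q-step-false e dead        = refl

  W Boundary : ℕSeries
  W        = countFinal live
  Boundary = countFinal atBoundary

  Allow Zeros Ones : ℕ → ℕSeries
  Allow e = countFinal (allowance e)
  Zeros e = countFinal (zerosWith e)
  Ones  e = countFinal (onesWith e)

  W-split : W ≐ Allow 0 ⊕ countFinal (λ s → live (step s true))
  W-split n k = trans (countFinal-split live (allowance 0) n k)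
                      (cong₂ _+_ (countFinal-cong live-allowance n k) (countFinal-cong live-step-true n k))

  W-recurrence : W ⊕ shiftℕ 1 1 (Allow 0) ≐ δ ⊕ shiftℕ 1 1 W ⊕ shiftℕ 1 0 W
  W-recurrence zero    zero    = refl
  W-recurrence zero    (suc k) = refl
  W-recurrence (suc n) zero    = begin
    W (suc n) 0 + 0                                ≡⟨ +-identityʳ _ ⟩
    W (suc n) 0                                    ≡⟨ countFinal-suc live n 0 ⟩
    countFinal (λ s → live (step s false)) n 0 + 0 ≡⟨ +-identityʳ _ ⟩
    countFinal (λ s → live (step s false)) n 0     ≡⟨ countFinal-cong live-step-false n 0 ⟩
    W n 0                                          ∎
    where open ≡-Reasoning
  W-recurrence (suc n) (suc k) = begin
    W (suc n) (suc k) + Allow 0 n k                 ≡⟨ cong (_+ Allow 0 n k) (countFinal-suc live n (suc k)) ⟩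
    countFinal (λ s → live (step s false)) n (suc k) + survivors + Allow 0 n k
      ≡⟨ cong (λ x → x + survivors + Allow 0 n k) (countFinal-cong live-step-false n (suc k)) ⟩
    W n (suc k) + survivors + Allow 0 n k           ≡⟨ xy∙z≈xz∙y (W n (suc k)) survivors (Allow 0 n k) ⟩
    W n (suc k) + Allow 0 n k + survivors           ≡⟨ +-assoc (W n (suc k)) (Allow 0 n k) survivors ⟩
    W n (suc k) + (Allow 0 n k + survivors)         ≡⟨ cong (W n (suc k) +_) (W-split n k) ⟨
    W n (suc k) + W n k                             ≡⟨ +-comm (W n (suc k)) (W n k) ⟩
    W n k + W n (suc k)                             ∎
    where
    open ≡-Reasoning
    survivors = countFinal (λ s → live (step s true)) n k

  Boundary-recurrence : Boundary ⊕ shiftℕ 1 1 (Allow 0) ≐ δ ⊕ shiftℕ 1 1 W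
  Boundary-recurrence zero    zero    = refl
  Boundary-recurrence zero    (suc k) = refl
  Boundary-recurrence (suc n) zero    =
    trans (+-identityʳ _) (trans (countFinal-suc atBoundary n 0)
          (cong (_+ 0) (countFinal-never atBoundary-step-false n 0)))
  Boundary-recurrence (suc n) (suc k) = begin
    Boundary (suc n) (suc k) + Allow 0 n k
      ≡⟨ cong (_+ Allow 0 n k) (countFinal-suc atBoundary n (suc k)) ⟩
    countFinal (λ s → atBoundary (step s false)) n (suc k) + countFinal (λ s → atBoundary (step s true)) n k + Allow 0 n k
      ≡⟨ cong₂ (λ x y → x + y + Allow 0 n k) (countFinal-never atBoundary-step-false n (suc k))
                                               (countFinal-cong atBoundary-step-true n k) ⟩
    countFinal (λ s → live (step s true)) n k + Allow 0 n k
      ≡⟨ +-comm _ (Allow 0 n k) ⟩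
    Allow 0 n k + countFinal (λ s → live (step s true)) n k
      ≡⟨ W-split n k ⟨
    W n k ∎
    where open ≡-Reasoning

  Allow-split : ∀ e → Allow e ≐ Zeros e ⊕ Ones e
  Allow-split e n k = trans (countFinal-split (allowance e) inZeroRun n k)
    (cong₂ _+_ (countFinal-cong (allowance-inZeroRun e) n k) (countFinal-cong (allowance-inOneRun e) n k))

  Ones-transfer : ∀ e → Ones e ≐ shiftℕ 1 1 (Allow (suc e))
  Ones-transfer e n k = trans (countFinal-after-1 (onesWith e) refl (onesWith-step-false e) n k)
                              (shiftℕ-cong 1 1 (countFinal-cong (onesWith-step-true e)) n k)

  Zeros-<p : ∀ {e} → e < p → ∀ n k → Zeros e n k ≡ 0
  Zeros-<p {e} e<p n k = trans (countFinal-after-0 (zerosWith e) refl (zerosWith-step-true e) n k) (shifted n)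
    where
    shifted : ∀ n → shiftℕ 1 0 (countFinal (λ s → zerosWith e (step s false))) n k ≡ 0
    shifted zero    = refl
    shifted (suc n) = countFinal-never (λ s → zerosWith-<p-step-false s e<p) n k

  Zeros-p : Zeros p ≐ shiftℕ 1 0 Boundary
  Zeros-p n k = trans (countFinal-after-0 (zerosWith p) refl (zerosWith-step-true p) n k)
                      (shiftℕ-cong 1 0 (countFinal-cong zerosWith-p-step-false) n k)

  Zeros-+q : ∀ e → Zeros (e + q) ≐ shiftℕ 1 0 (Zeros e)
  Zeros-+q e n k = trans (countFinal-after-0 (zerosWith (e + q)) refl (zerosWith-step-true (e + q)) n k)
                         (shiftℕ-cong 1 0 (countFinal-cong (zerosWith-+q-step-false e)) n k)

  -- The last 0 of the current 0-run contributed q to the allowance.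
  Allow-+q : ∀ e → Allow (e + q) ≐ shiftℕ 1 0 (Allow e)
  Allow-+q e zero    zero    = refl
  Allow-+q e zero    (suc k) = refl
  Allow-+q e (suc n) k       = begin
    Allow (e + q) (suc n) k                       ≡⟨ Allow-split (e + q) (suc n) k ⟩
    Zeros (e + q) (suc n) k + Ones (e + q) (suc n) k ≡⟨ cong₂ _+_ (Zeros-+q e (suc n) k) (ones k) ⟩
    Zeros e n k + Ones e n k                      ≡⟨ Allow-split e n k ⟨
    Allow e n k                                   ∎
    where
    open ≡-Reasoning
    ones : ∀ k → Ones (e + q) (suc n) k ≡ Ones e n k
    ones zero    = trans (Ones-transfer (e + q) (suc n) 0)
                         (sym (trans (Ones-transfer e n 0) (shiftℕ-suc-zero 1 0 (Allow (suc e)) n)))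
    ones (suc k) = begin
      Ones (e + q) (suc n) (suc k)       ≡⟨ Ones-transfer (e + q) (suc n) (suc k) ⟩
      Allow (suc e + q) n k              ≡⟨ Allow-+q (suc e) n k ⟩
      shiftℕ 1 0 (Allow (suc e)) n k      ≡⟨ shiftℕ-suc-suc 1 0 (Allow (suc e)) n k ⟨
      shiftℕ 1 1 (Allow (suc e)) n (suc k) ≡⟨ Ones-transfer e n (suc k) ⟨
      Ones e n (suc k)                   ∎

  Allow-below-p : ∀ i e → i + e ≡ p → Allow e ≐ shiftℕ i i (Allow p)
  Allow-below-p zero    e refl n k = refl
  Allow-below-p (suc i) e i+e≡p n k = begin
    Allow e n k                                 ≡⟨ Allow-split e n k ⟩
    Zeros e n k + Ones e n k                    ≡⟨ cong (_+ Ones e n k) (Zeros-<p e<p n k) ⟩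
    Ones e n k                                  ≡⟨ Ones-transfer e n k ⟩
    shiftℕ 1 1 (Allow (suc e)) n k              ≡⟨ shiftℕ-cong 1 1 (Allow-below-p i (suc e) (trans (+-suc i e) i+e≡p)) n k ⟩
    shiftℕ 1 1 (shiftℕ i i (Allow p)) n k       ≡⟨ shiftℕ-shiftℕ 1 1 i i (Allow p) n k ⟩
    shiftℕ (suc i) (suc i) (Allow p) n k        ∎
    where
    open ≡-Reasoning
    e<p : e < p
    e<p = subst (e <_) i+e≡p (m<n+m e z<s)

  Allow-p : Allow p ≐ shiftℕ 1 0 (δ ⊕ shiftℕ 1 1 W)
  Allow-p n k = begin
    Allow p n k                                            ≡⟨ Allow-split p n k ⟩
    Zeros p n k + Ones p n k                               ≡⟨ cong₂ _+_ (Zeros-p n k) (Ones-transfer p n k) ⟩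
    shiftℕ 1 0 Boundary n k + shiftℕ 1 1 (Allow q) n k
      ≡⟨ cong (shiftℕ 1 0 Boundary n k +_) (shiftℕ-cong 1 1 (Allow-+q 0) n k) ⟩
    shiftℕ 1 0 Boundary n k + shiftℕ 1 1 (shiftℕ 1 0 (Allow 0)) n k
      ≡⟨ cong (shiftℕ 1 0 Boundary n k +_) (shiftℕ-shiftℕ 1 1 1 0 (Allow 0) n k) ⟩
    shiftℕ 1 0 Boundary n k + shiftℕ 2 1 (Allow 0) n k
      ≡⟨ cong (shiftℕ 1 0 Boundary n k +_) (shiftℕ-shiftℕ 1 0 1 1 (Allow 0) n k) ⟨
    shiftℕ 1 0 Boundary n k + shiftℕ 1 0 (shiftℕ 1 1 (Allow 0)) n k
      ≡⟨ shiftℕ-⊕ 1 0 Boundary (shiftℕ 1 1 (Allow 0)) n k ⟨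
    shiftℕ 1 0 (Boundary ⊕ shiftℕ 1 1 (Allow 0)) n k        ≡⟨ shiftℕ-cong 1 0 Boundary-recurrence n k ⟩
    shiftℕ 1 0 (δ ⊕ shiftℕ 1 1 W) n k                       ∎
    where open ≡-Reasoning

  Allow-0 : Allow 0 ≐ shiftℕ q p (δ ⊕ shiftℕ 1 1 W)
  Allow-0 n k = begin
    Allow 0 n k                                   ≡⟨ Allow-below-p p 0 (+-identityʳ p) n k ⟩
    shiftℕ p p (Allow p) n k                      ≡⟨ shiftℕ-cong p p Allow-p n k ⟩
    shiftℕ p p (shiftℕ 1 0 (δ ⊕ shiftℕ 1 1 W)) n k ≡⟨ shiftℕ-shiftℕ p p 1 0 _ n k ⟩
    shiftℕ (p + 1) (p + 0) (δ ⊕ shiftℕ 1 1 W) n k  ≡⟨ shiftℕ-index _ (+-comm p 1) (+-identityʳ p) n k ⟩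
    shiftℕ q p (δ ⊕ shiftℕ 1 1 W) n k              ∎
    where open ≡-Reasoning

  W-identity : W ⊕ shiftℕ (q + 2) (q + 1) W ⊕ shiftℕ (q + 1) q δ ≐ δ ⊕ shiftℕ 1 1 W ⊕ shiftℕ 1 0 W
  W-identity n k = begin
    W n k + shiftℕ (q + 2) (q + 1) W n k + shiftℕ (q + 1) q δ n k
      ≡⟨ xy∙z≈xz∙y (W n k) _ _ ⟩
    W n k + shiftℕ (q + 1) q δ n k + shiftℕ (q + 2) (q + 1) W n k
      ≡⟨ +-assoc (W n k) _ _ ⟩
    W n k + (shiftℕ (q + 1) q δ n k + shiftℕ (q + 2) (q + 1) W n k)
      ≡⟨ cong (W n k +_) shifted-Allow-0 ⟨
    W n k + shiftℕ 1 1 (Allow 0) n k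
      ≡⟨ W-recurrence n k ⟩
    δ n k + shiftℕ 1 1 W n k + shiftℕ 1 0 W n k ∎
    where
    open ≡-Reasoning
    shifted-Allow-0 : shiftℕ 1 1 (Allow 0) n k ≡ shiftℕ (q + 1) q δ n k + shiftℕ (q + 2) (q + 1) W n k
    shifted-Allow-0 = begin
      shiftℕ 1 1 (Allow 0) n k                                  ≡⟨ shiftℕ-cong 1 1 Allow-0 n k ⟩
      shiftℕ 1 1 (shiftℕ q p (δ ⊕ shiftℕ 1 1 W)) n k             ≡⟨ shiftℕ-shiftℕ 1 1 q p _ n k ⟩
      shiftℕ (suc q) q (δ ⊕ shiftℕ 1 1 W) n k                    ≡⟨ shiftℕ-⊕ (suc q) q δ (shiftℕ 1 1 W) n k ⟩
      shiftℕ (suc q) q δ n k + shiftℕ (suc q) q (shiftℕ 1 1 W) n k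
        ≡⟨ cong₂ _+_ (shiftℕ-index δ (+-comm 1 q) refl n k) (shiftℕ-shiftℕ (suc q) q 1 1 W n k) ⟩
      shiftℕ (q + 1) q δ n k + shiftℕ (suc q + 1) (q + 1) W n k
        ≡⟨ cong (shiftℕ (q + 1) q δ n k +_) (shiftℕ-index W (sym (+-suc q 1)) refl n k) ⟩
      shiftℕ (q + 1) q δ n k + shiftℕ (q + 2) (q + 1) W n k      ∎


  QWord↔Counted : ∀ {n k} → QWord q n k ↔ Counted accepts n k
  QWord↔Counted = mk↔ₛ′ (λ (qword u l o qd) → counted u l o (Equivalence.to (QD⇔accepts u) qd))
                        (λ (counted u l o h) → qword u l o (Equivalence.from (QD⇔accepts u) h))
                        (λ _ → refl) (λ _ → refl)

  count-QWord : ∀ {w : ℕ → ℕ → ℕ} → (∀ n k → Fin (w n k) ↔ QWord q n k) → w ≐ W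
  count-QWord w↔ n k = count-unique (↔-trans (w↔ n k) QWord↔Counted)

-- Integer coefficients

open import Data.Integer using (ℤ; +_; _-_) renaming (_+_ to _+ℤ_)
open import Data.Integer.Tactic.RingSolver using (solve-∀)
open import Data.Nat using (_≤_)

toℤ : ℕSeries → Series
toℤ f n k = + f n k

shift-toℤ : ∀ i j f n k → shift i j (toℤ f) n k ≡ + shiftℕ i j f n k
shift-toℤ zero    zero    f n       k       = refl
shift-toℤ (suc i) j       f zero    k       = refl
shift-toℤ (suc i) j       f (suc n) k       = shift-toℤ i j f n k
shift-toℤ zero    (suc j) f n       zero    = refl
shift-toℤ zero    (suc j) f n       (suc k) = shift-toℤ zero j f n k

shiftℕ-δ : ∀ i j n k → shiftℕ i j δ n k ≡ (if (i ≡ᵇ n) ∧ (j ≡ᵇ k) then 1 else 0)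
shiftℕ-δ zero    zero    zero    zero    = refl
shiftℕ-δ zero    zero    zero    (suc k) = refl
shiftℕ-δ zero    zero    (suc n) k       = refl
shiftℕ-δ (suc i) j       zero    k       = refl
shiftℕ-δ (suc i) j       (suc n) k       = shiftℕ-δ i j n k
shiftℕ-δ zero    (suc j) zero    zero    = refl
shiftℕ-δ zero    (suc j) (suc n) zero    = refl
shiftℕ-δ zero    (suc j) n       (suc k) = shiftℕ-δ zero j n k

mono-shiftℕ-δ : ∀ i j n k → mono i j n k ≡ + shiftℕ i j δ n k
mono-shiftℕ-δ i j n k = trans mono-if (cong +_ (sym (shiftℕ-δ i j n k)))
  where
  mono-if : mono i j n k ≡ + (if (i ≡ᵇ n) ∧ (j ≡ᵇ k) then 1 else 0)
  mono-if with i ≡ᵇ n | j ≡ᵇ k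
  ... | true  | true  = refl
  ... | true  | false = refl
  ... | false | _     = refl

cancel-ℤ : ∀ a b c d e f → a + d + f ≡ e + b + c → ((+ a - + b) - + c) +ℤ + d ≡ + e - + f
cancel-ℤ a b c d e f eq = begin
  ((+ a - + b) - + c) +ℤ + d                  ≡⟨ regroup (+ a) (+ b) (+ c) (+ d) (+ f) ⟩
  (+ a +ℤ + d +ℤ + f) - (+ b +ℤ + c +ℤ + f)   ≡⟨ cong (λ x → x - (+ b +ℤ + c +ℤ + f)) (cong +_ eq) ⟩
  (+ e +ℤ + b +ℤ + c) - (+ b +ℤ + c +ℤ + f)   ≡⟨ cancel (+ e) (+ b) (+ c) (+ f) ⟩
  + e - + f                                   ∎
  where
  open ≡-Reasoning
  regroup : ∀ A B C D F → ((A - B) - C) +ℤ D ≡ (A +ℤ D +ℤ F) - (B +ℤ C +ℤ F)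
  regroup = solve-∀
  cancel : ∀ E B C F → (E +ℤ B +ℤ C) - (B +ℤ C +ℤ F) ≡ E - F
  cancel = solve-∀

theorem2 : (q : ℕ) → 1 ≤ q → (w : ℕ → ℕ → ℕ) →
    (∀ n k → Fin (w n k) ↔ QWord q n k) →
    ∀ n k →
    ((((+ w n k) - shift 1 1 (λ i j → + w i j) n k) - shift 1 0 (λ i j → + w i j) n k)
    +ℤ shift (q + 2) (q + 1) (λ i j → + w i j) n k)
    ≡ mono 0 0 n k - mono (q + 1) q n k
theorem2 (suc p) _ w w↔ n k = begin
  ((+ w n k - shift 1 1 (toℤ w) n k) - shift 1 0 (toℤ w) n k) +ℤ shift (q + 2) (q + 1) (toℤ w) n k
    ≡⟨ cong₂ _+ℤ_ (cong₂ _-_ (cong (+ w n k -_) (shift-toℤ 1 1 w n k)) (shift-toℤ 1 0 w n k))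
                  (shift-toℤ (q + 2) (q + 1) w n k) ⟩
  lhs w
    ≡⟨ cong₂ _+ℤ_ (cong₂ _-_ (cong₂ _-_ (cong +_ (w≐W n k)) (cong +_ (shiftℕ-cong 1 1 w≐W n k)))
                             (cong +_ (shiftℕ-cong 1 0 w≐W n k)))
                  (cong +_ (shiftℕ-cong (q + 2) (q + 1) w≐W n k)) ⟩
  lhs W
    ≡⟨ cancel-ℤ (W n k) (shiftℕ 1 1 W n k) (shiftℕ 1 0 W n k) (shiftℕ (q + 2) (q + 1) W n k)
                (δ n k) (shiftℕ (q + 1) q δ n k) (W-identity n k) ⟩
  + δ n k - + shiftℕ (q + 1) q δ n k
    ≡⟨ cong₂ _-_ (mono-shiftℕ-δ 0 0 n k) (mono-shiftℕ-δ (q + 1) q n k) ⟨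
  mono 0 0 n k - mono (q + 1) q n k ∎
  where
  open ≡-Reasoning
  open QAutomaton p
  w≐W : w ≐ W
  w≐W = count-QWord w↔
  lhs : ℕSeries → ℤ
  lhs f = ((+ f n k - + shiftℕ 1 1 f n k) - + shiftℕ 1 0 f n k) +ℤ + shiftℕ (q + 2) (q + 1) f n k
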